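{- For $n\ge1$, $Q_n(x,z)=\Xi(P_n(x,z))$, where $\Xi$ is the linear operator sending $z^0x^k\mapsto z^1x^k$ and $z^1x^k\mapsto x^{k+1}$. In other words, for every $k$: the number of $\sigma\in\mathcal{S}_n$ beginning with an odd number and having $\overrightarrow{des}_E(\sigma)=k$ equals the number of $\pi\in\mathcal{S}_n$ beginning with an odd number and having $\overrightarrow{des}_O(\pi)=k$; and the number of $\sigma\in\mathcal{S}_n$ beginning with an even number and having $\overrightarrow{des}_E(\sigma)=k$ equals the number of $\pi\in\mathcal{S}_n$ beginning with an even number and having $\overrightarrow{des}_O(\pi)=k+1$.
   Context: $\mathcal{S}_n$ denotes the set of permutations $\sigma=\sigma_1\cdots\sigma_n$ of $\{1,\dots,n\}$. $\overrightarrow{des}_E(\sigma)$ (resp. $\overrightarrow{des}_O(\sigma)$) is the number of indices $i\in\{1,\dots,n-1\}$ with $\sigma_i>\sigma_{i+1}$ and $\sigma_{i+1}$ even (resp. odd). $P_n(x,z)=\sum_{\sigma\in\mathcal{S}_n}x^{\overrightarrow{des}_E(\sigma)}z^{\chi(\sigma_1\text{ even})}$ and $Q_n(x,z)=\sum_{\sigma\in\mathcal{S}_n}x^{\overrightarrow{des}_O(\sigma)}z^{\chi(\sigma_1\text{ odd})}$, where $\chi(\cdot)$ is $1$ if the condition holds and $0$ otherwise. -}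

module Defs where

open import Data.Nat using (ℕ; zero; suc; _<ᵇ_; _+_)
open import Data.Nat.Properties using (_≟_)
open import Data.Fin using (Fin; toℕ)
open import Data.Fin.Properties using (all?) renaming (_≟_ to _≟F_)
open import Data.Bool.Properties using () renaming (_≟_ to _≟B_)
open import Relation.Nullary.Decidable using (_→-dec_; _×-dec_)
open import Data.Vec using (Vec; []; _∷_; lookup)
open import Data.List using (List; []; _∷_; map; concatMap; filter; length; allFin)
open import Data.Bool using (Bool; true; false; if_then_else_; not)
open import Relation.Nullary using (Dec; ¬_)
open import Relation.Binary.PropositionalEquality using (_≡_)

words : {A : Set} → List A → (m : ℕ) → List (Vec A m)
words xs zero = [] ∷ []
words xs (suc m) = concatMap (λ x → map (x ∷_) (words xs m)) xs

-- a permutation of {1..n} is an injective word Fin n → Fin n (value of position i is toℕ + 1)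
IsPerm : {n : ℕ} → Vec (Fin n) n → Set
IsPerm {n} v = (i j : Fin n) → lookup v i ≡ lookup v j → i ≡ j

isPerm? : {n : ℕ} → (v : Vec (Fin n) n) → Dec (IsPerm v)
isPerm? {n} v = all? λ i → all? λ j → (lookup v i ≟F lookup v j) →-dec (i ≟F j)

Sn : (n : ℕ) → List (Vec (Fin n) n)
Sn n = filter isPerm? (words (allFin n) n)

val : {n : ℕ} → Fin n → ℕ
val k = suc (toℕ k)

even : ℕ → Bool
even zero = true
even (suc m) = not (even m)

desWith : (ℕ → Bool) → {m n : ℕ} → Vec (Fin n) m → ℕ
desWith p [] = 0
desWith p (a ∷ []) = 0
desWith p (a ∷ b ∷ w) =
  (if (val b <ᵇ val a) then (if p (val b) then 1 else 0) else 0) + desWith p (b ∷ w)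

desE desO : {m n : ℕ} → Vec (Fin n) m → ℕ
desE = desWith even
desO = desWith (λ v → not (even v))

first : {n : ℕ} → Vec (Fin (suc n)) (suc n) → ℕ
first (a ∷ _) = val a

count : (m : ℕ) → (firstEven : Bool) → (stat : Vec (Fin (suc m)) (suc m) → ℕ) → ℕ → ℕ
count m b stat k = length (filter (λ σ → (even (first σ) ≟B b) ×-dec (stat σ ≟ k)) (Sn (suc m)))

-- Every permutation of 1..n+1 arises exactly once by inserting n+1 into a permutation τ of 1..n.
-- Record of each permutation its profile (σ₁ even?, number of descents onto even values), resp.
-- onto odd values.  The profiles of the n+1 insertions into τ depend only on n and on the profile
-- of τ: putting n+1 in front creates a descent onto the old first letter, and any other slot
-- creates one exactly when it precedes a value of the right parity that is not yet a descent
-- bottom.  On every profile that actually occurs, Ξ carries the even recursion to the odd one up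
-- to reordering, so by induction on n it maps the multiset of even profiles of S_n onto the
-- multiset of odd profiles.

module Submission where

open import Defs
open import Data.Fin using (Fin; fromℕ<; punchOut) renaming (zero to fzero; suc to fsuc)
open import Data.Fin.Properties
  using (any?; toℕ<n; toℕ-fromℕ<; toℕ-injective; punchOut-injective; injective⇒≤)
  renaming (_≟_ to _≟ᶠ_; suc-injective to fsuc-injective)
open import Data.Vec using (Vec; []; _∷_; lookup)
import Data.Vec.Properties as Vecₚ
open import Data.Bool using (Bool; true; false; not; _∧_; if_then_else_)
open import Data.Bool.Properties using (T-≡; ¬-not) renaming (_≟_ to _≟ᵇ_)
open import Data.Nat using (ℕ; zero; suc; _+_; _∸_; _≤_; _<_; z≤n; s≤s; _<ᵇ_)
open import Data.Nat.ListAction using (sum)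
open import Data.Nat.ListAction.Properties using (sum-↭)
open import Data.Nat.Properties
  using ( _≟_; +-commutativeSemigroup; suc-injective; +-assoc; +-suc; +-∸-assoc; m+n∸m≡n; m+n∸n≡m
        ; m≤m+n; m≤n+m; m∸n≤m; +-monoˡ-≤; <⇒≢; <⇒≱; <⇒≤; <⇒<ᵇ; <ᵇ⇒<; 1+n≰n; ≤-trans)
open import Algebra.Properties.CommutativeSemigroup +-commutativeSemigroup using (x∙yz≈y∙xz)
open import Data.List
  using (List; []; _∷_; _++_; map; concatMap; filter; length; replicate; allFin; applyDownFrom)
open import Data.List.Properties
  using ( ∷-injective; map-∘; map-cong; map-++; map-replicate; map-concatMap; concatMap-map
        ; filter-accept; filter-reject; filter-all; length-applyDownFrom)
open import Data.List.Membership.Propositional using (_∈_; _∉_; find)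
open import Data.List.Membership.Propositional.Properties
  using ( ∈-map⁻; ∈-map⁺; ∈-concatMap⁻; ∈-concatMap⁺; ∈-filter⁻; ∈-filter⁺; ∈-∃++; ∈-allFin
        ; ∈-applyDownFrom⁺; ∈-applyDownFrom⁻)
open import Data.List.Relation.Unary.All as All using (All; []; _∷_)
open import Data.List.Relation.Unary.Any as Any using (here; there)
open import Data.List.Relation.Unary.Unique.Propositional using (Unique; []; _∷_)
import Data.List.Relation.Unary.Unique.Propositional.Properties as Unique
open import Data.List.Relation.Binary.Permutation.Propositional as Perm
  using (_↭_; prep; swap; ↭-refl; module PermutationReasoning; ↭-sym; ↭-trans; ↭-reflexive; ↭⇒↭ₛ)
open import Data.List.Relation.Binary.Permutation.Propositional.Properties
  using (↭-length; filter-↭; map⁺; ++⁺; ++⁺ˡ; shift; shifts; drop-mid; ↭-empty-inv; All-resp-↭; ∈-resp-↭)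
import Data.List.Relation.Binary.Permutation.Setoid.Properties as PermutationSetoid
open import Data.List.Relation.Binary.BagAndSetEquality using (∼bag⇒↭)
open import Data.List.Membership.Propositional.Properties.WithK using (unique∧set⇒bag)
open import Data.Product using (_×_; _,_; ∃; proj₁; proj₂)
open import Data.Product.Properties using (≡-dec; ×-≡,≡↔≡)
open import Function using (_∘_; id; case_of_; _⇔_; mk⇔; Equivalence)
open import Function.Properties.Inverse using (↔⇒⇔)
open import Level using (0ℓ)
open import Relation.Binary using (DecidableEquality)
open import Relation.Binary.PropositionalEquality
open import Relation.Nullary using (¬_; yes; no; contradiction)
open import Relation.Nullary.Decidable using (¬?)
open import Relation.Unary using (Pred; Decidable)

module _ {A B : Set} where

  length-filter-map : {P : Pred A 0ℓ} {Q : Pred B 0ℓ} (P? : Decidable P) (Q? : Decidable Q)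
                      (f : A → B) → (∀ x → P x ⇔ Q (f x)) →
                      ∀ xs → length (filter P? xs) ≡ length (filter Q? (map f xs))
  length-filter-map P? Q? f P⇔Q [] = refl
  length-filter-map P? Q? f P⇔Q (x ∷ xs) with P? x | Q? (f x)
  ... | yes _  | yes _  = cong suc (length-filter-map P? Q? f P⇔Q xs)
  ... | yes px | no ¬qx = contradiction (Equivalence.to (P⇔Q x) px) ¬qx
  ... | no ¬px | yes qx = contradiction (Equivalence.from (P⇔Q x) qx) ¬px
  ... | no _   | no _   = length-filter-map P? Q? f P⇔Q xs

  concatMap⁺ : (f : A → List B) {xs ys : List A} → xs ↭ ys → concatMap f xs ↭ concatMap f ys
  concatMap⁺ f Perm.refl        = ↭-refl
  concatMap⁺ f (prep x p)       = ++⁺ˡ (f x) (concatMap⁺ f p)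
  concatMap⁺ f (swap x y p)     = ↭-trans (shifts (f x) (f y)) (++⁺ˡ (f y) (++⁺ˡ (f x) (concatMap⁺ f p)))
  concatMap⁺ f (Perm.trans p q) = ↭-trans (concatMap⁺ f p) (concatMap⁺ f q)

  concatMap-cong-↭ : {f g : A → List B} (xs : List A) → (∀ {x} → x ∈ xs → f x ↭ g x) →
                     concatMap f xs ↭ concatMap g xs
  concatMap-cong-↭ []       f↭g = ↭-refl
  concatMap-cong-↭ (x ∷ xs) f↭g = ++⁺ (f↭g (here refl)) (concatMap-cong-↭ xs (f↭g ∘ there))

  concatMap-unique : (f : A → List B) {xs : List A} → Unique xs →
                     (∀ {x} → x ∈ xs → Unique (f x)) →
                     (∀ {x y z} → x ∈ xs → y ∈ xs → z ∈ f x → z ∈ f y → x ≡ y) →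
                     Unique (concatMap f xs)
  concatMap-unique f []                   _  _       = []
  concatMap-unique f {x ∷ xs} (x∉xs ∷ xs!) f! collide =
    Unique.++⁺ (f! (here refl))
               (concatMap-unique f xs! (f! ∘ there) (λ p q → collide (there p) (there q)))
               disjoint
    where
    disjoint : ∀ {z} → ¬ (z ∈ f x × z ∈ concatMap f xs)
    disjoint (z∈fx , z∈rest) with find (∈-concatMap⁻ f {xs = xs} z∈rest)
    ... | y , y∈xs , z∈fy with collide (here refl) (there y∈xs) z∈fx z∈fy
    ... | refl = All.lookup x∉xs y∈xs refl

unique∧⊆∧⊇⇒↭ : {A : Set} {xs ys : List A} → Unique xs → Unique ys →
               (∀ {x} → x ∈ xs → x ∈ ys) → (∀ {x} → x ∈ ys → x ∈ xs) → xs ↭ ys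
unique∧⊆∧⊇⇒↭ xs! ys! xs⊆ys ys⊆xs = ∼bag⇒↭ (unique∧set⇒bag xs! ys! (mk⇔ xs⊆ys ys⊆xs))

𝟙 : Bool → ℕ
𝟙 b = if b then 1 else 0

tally : {A : Set} → (A → Bool) → List A → ℕ
tally p = sum ∘ map (𝟙 ∘ p)

tally-↭ : {A : Set} (p : A → Bool) {xs ys : List A} → xs ↭ ys → tally p xs ≡ tally p ys
tally-↭ p = sum-↭ ∘ map⁺ (𝟙 ∘ p)

tally+tally-not : {A : Set} (p : A → Bool) (xs : List A) → tally p xs + tally (not ∘ p) xs ≡ length xs
tally+tally-not p [] = refl
tally+tally-not p (x ∷ xs) with p x
... | true  = cong suc (tally+tally-not p xs)
... | false = trans (+-suc (tally p xs) _) (cong suc (tally+tally-not p xs))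

↭-trues++falses : (bs : List Bool) → bs ↭ replicate (tally id bs) true ++ replicate (tally not bs) false
↭-trues++falses []           = ↭-refl
↭-trues++falses (true ∷ bs)  = prep true (↭-trues++falses bs)
↭-trues++falses (false ∷ bs) =
  ↭-trans (prep false (↭-trues++falses bs)) (↭-sym (shift false (replicate (tally id bs) true) _))

module _ {A : Set} where

  insertions : A → List A → List (List A)
  insertions x []       = (x ∷ []) ∷ []
  insertions x (a ∷ as) = (x ∷ a ∷ as) ∷ map (a ∷_) (insertions x as)

  ∈-insertions⁻ : ∀ x as {bs} → bs ∈ insertions x as → bs ↭ x ∷ as
  ∈-insertions⁻ x []       (here refl) = ↭-refl
  ∈-insertions⁻ x (a ∷ as) (here refl) = ↭-refl
  ∈-insertions⁻ x (a ∷ as) (there bs∈) with ∈-map⁻ (a ∷_) bs∈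
  ... | cs , cs∈ , refl = ↭-trans (prep a (∈-insertions⁻ x as cs∈)) (swap a x ↭-refl)

  ∈-insertions⁺ : ∀ x as bs → as ++ x ∷ bs ∈ insertions x (as ++ bs)
  ∈-insertions⁺ x []       []       = here refl
  ∈-insertions⁺ x []       (b ∷ bs) = here refl
  ∈-insertions⁺ x (a ∷ as) bs       = there (∈-map⁺ (a ∷_) (∈-insertions⁺ x as bs))

  insertions-unique : ∀ x as → x ∉ as → Unique (insertions x as)
  insertions-unique x []       _    = [] ∷ []
  insertions-unique x (a ∷ as) x∉as =
    All.tabulate head≢ ∷
    Unique.map⁺ (λ eq → proj₂ (∷-injective eq)) (insertions-unique x as (x∉as ∘ there))
    where
    head≢ : ∀ {bs} → bs ∈ map (a ∷_) (insertions x as) → x ∷ a ∷ as ≢ bs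
    head≢ bs∈ eq with ∈-map⁻ (a ∷_) bs∈
    ... | cs , _ , refl = x∉as (here (proj₁ (∷-injective eq)))

  module _ (_≟_ : DecidableEquality A) where

    remove : A → List A → List A
    remove x = filter (¬? ∘ (_≟ x))

    remove-insertions : ∀ x as {bs} → x ∉ as → bs ∈ insertions x as → remove x bs ≡ as
    remove-insertions x []       x∉as (here refl) = filter-reject (¬? ∘ (_≟ x)) (λ x≢x → x≢x refl)
    remove-insertions x (a ∷ as) x∉as (here refl) =
      trans (filter-reject (¬? ∘ (_≟ x)) (λ x≢x → x≢x refl))
            (filter-all (¬? ∘ (_≟ x)) (All.tabulate λ y∈as y≡x → x∉as (subst (_∈ _) y≡x y∈as)))
    remove-insertions x (a ∷ as) x∉as (there bs∈) with ∈-map⁻ (a ∷_) bs∈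
    ... | cs , cs∈ , refl =
      trans (filter-accept (¬? ∘ (_≟ x)) (λ a≡x → x∉as (here (sym a≡x))))
            (cong (a ∷_) (remove-insertions x as (x∉as ∘ there) cs∈))

values : ℕ → List ℕ
values = applyDownFrom suc

values-unique : ∀ n → Unique (values n)
values-unique n = Unique.applyDownFrom⁺₁ suc n λ j<i _ eq → <⇒≢ j<i (sym (suc-injective eq))

values-bounded : ∀ n → All (_≤ n) (values n)
values-bounded n = All.tabulate λ x∈ → case ∈-applyDownFrom⁻ suc x∈ of λ { (i , i<n , refl) → i<n }

1+n∉values : ∀ n → suc n ∉ values n
1+n∉values n = 1+n≰n ∘ All.lookup (values-bounded n)

perms : ℕ → List (List ℕ)
perms zero    = [] ∷ []
perms (suc n) = concatMap (insertions (suc n)) (perms n)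

∈-perms⁻ : ∀ n {τ} → τ ∈ perms n → τ ↭ values n
∈-perms⁻ zero    (here refl) = ↭-refl
∈-perms⁻ (suc n) τ∈ with find (∈-concatMap⁻ (insertions (suc n)) {xs = perms n} τ∈)
... | σ , σ∈ , τ∈ins = ↭-trans (∈-insertions⁻ (suc n) σ τ∈ins) (prep (suc n) (∈-perms⁻ n σ∈))

∈-perms⁺ : ∀ n {τ} → τ ↭ values n → τ ∈ perms n
∈-perms⁺ zero τ↭ with ↭-empty-inv τ↭
... | refl = here refl
∈-perms⁺ (suc n) τ↭ with ∈-∃++ (∈-resp-↭ (↭-sym τ↭) (here refl))
... | as , bs , refl = ∈-concatMap⁺ (insertions (suc n))
  (Any.map (λ { refl → ∈-insertions⁺ (suc n) as bs }) (∈-perms⁺ n (drop-mid as [] τ↭)))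

perms-unique : ∀ n → Unique (perms n)
perms-unique zero    = [] ∷ []
perms-unique (suc n) = concatMap-unique (insertions (suc n)) (perms-unique n)
  (λ σ∈ → insertions-unique (suc n) _ (fresh σ∈))
  (λ σ∈ σ′∈ τ∈ τ∈′ → trans (sym (remove-insertions _≟_ (suc n) _ (fresh σ∈) τ∈))
                            (remove-insertions _≟_ (suc n) _ (fresh σ′∈) τ∈′))
  where
  fresh : ∀ {σ} → σ ∈ perms n → suc n ∉ σ
  fresh σ∈ = 1+n∉values n ∘ ∈-resp-↭ (∈-perms⁻ n σ∈)

injective⇒surjective : ∀ {n} (f : Fin n → Fin n) → (∀ i j → f i ≡ f j → i ≡ j) →
                       ∀ j → ∃ λ i → f i ≡ j
injective⇒surjective {suc n} f f-inj j with any? (λ i → f i ≟ᶠ j)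
... | yes hit  = hit
... | no ¬hit = contradiction (injective⇒≤ {f = f′} f′-inj) 1+n≰n
  where
  f′ : Fin (suc n) → Fin n
  f′ i = punchOut {i = j} {j = f i} (λ j≡fi → ¬hit (i , sym j≡fi))
  f′-inj : ∀ {i k} → f′ i ≡ f′ k → i ≡ k
  f′-inj {i} {k} = f-inj i k ∘ punchOut-injective {i = j} _ _

val-injective : ∀ {n} {i j : Fin n} → val i ≡ val j → i ≡ j
val-injective = toℕ-injective ∘ suc-injective

∈-values⁺ : ∀ {n} (j : Fin n) → val j ∈ values n
∈-values⁺ j = ∈-applyDownFrom⁺ suc (toℕ<n j)

∈-values⁻ : ∀ {n x} → x ∈ values n → ∃ λ (j : Fin n) → x ≡ val j
∈-values⁻ p with ∈-applyDownFrom⁻ suc p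
... | i , i<n , refl = fromℕ< i<n , cong suc (sym (toℕ-fromℕ< i<n))

toValues : ∀ {m n} → Vec (Fin n) m → List ℕ
toValues []      = []
toValues (a ∷ v) = val a ∷ toValues v

toValues-injective : ∀ {m n} {v w : Vec (Fin n) m} → toValues v ≡ toValues w → v ≡ w
toValues-injective {v = []}    {[]}    _  = refl
toValues-injective {v = a ∷ v} {b ∷ w} eq =
  cong₂ _∷_ (val-injective (proj₁ (∷-injective eq))) (toValues-injective (proj₂ (∷-injective eq)))

∈-toValues⁺ : ∀ {m n} (v : Vec (Fin n) m) i → val (lookup v i) ∈ toValues v
∈-toValues⁺ (a ∷ v) fzero    = here refl
∈-toValues⁺ (a ∷ v) (fsuc i) = there (∈-toValues⁺ v i)

∈-toValues⁻ : ∀ {m n} (v : Vec (Fin n) m) {x} → x ∈ toValues v → ∃ λ i → x ≡ val (lookup v i)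
∈-toValues⁻ (a ∷ v) (here eq) = fzero , eq
∈-toValues⁻ (a ∷ v) (there p) with ∈-toValues⁻ v p
... | i , eq = fsuc i , eq

lookup-injective⇒toValues-unique : ∀ {m n} (v : Vec (Fin n) m) →
  (∀ i j → lookup v i ≡ lookup v j → i ≡ j) → Unique (toValues v)
lookup-injective⇒toValues-unique []      _     = []
lookup-injective⇒toValues-unique (a ∷ v) v-inj =
  All.tabulate a∉v ∷ lookup-injective⇒toValues-unique v (λ i j → fsuc-injective ∘ v-inj (fsuc i) (fsuc j))
  where
  a∉v : ∀ {x} → x ∈ toValues v → val a ≢ x
  a∉v x∈ a≡x with ∈-toValues⁻ v x∈
  ... | i , refl with v-inj fzero (fsuc i) (val-injective a≡x)
  ... | ()

toValues-unique⇒lookup-injective : ∀ {m n} (v : Vec (Fin n) m) →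
  Unique (toValues v) → ∀ i j → lookup v i ≡ lookup v j → i ≡ j
toValues-unique⇒lookup-injective (a ∷ v) _         fzero    fzero    _  = refl
toValues-unique⇒lookup-injective (a ∷ v) (a∉v ∷ _) fzero    (fsuc j) eq =
  contradiction (cong val eq) (All.lookup a∉v (∈-toValues⁺ v j))
toValues-unique⇒lookup-injective (a ∷ v) (a∉v ∷ _) (fsuc i) fzero    eq =
  contradiction (cong val (sym eq)) (All.lookup a∉v (∈-toValues⁺ v i))
toValues-unique⇒lookup-injective (a ∷ v) (_ ∷ v!)  (fsuc i) (fsuc j) eq =
  cong fsuc (toValues-unique⇒lookup-injective v v! i j eq)

IsPerm⇒toValues↭values : ∀ {n} (σ : Vec (Fin n) n) → IsPerm σ → toValues σ ↭ values n
IsPerm⇒toValues↭values {n} σ σ-inj =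
  unique∧⊆∧⊇⇒↭ (lookup-injective⇒toValues-unique σ σ-inj) (values-unique n) ⊆values values⊆
  where
  ⊆values : ∀ {x} → x ∈ toValues σ → x ∈ values n
  ⊆values x∈ with ∈-toValues⁻ σ x∈
  ... | i , refl = ∈-values⁺ (lookup σ i)
  values⊆ : ∀ {x} → x ∈ values n → x ∈ toValues σ
  values⊆ x∈ with ∈-values⁻ x∈
  ... | j , refl with injective⇒surjective (lookup σ) σ-inj j
  ... | i , refl = ∈-toValues⁺ σ i

fromValues : ∀ {m n} (xs : List ℕ) → length xs ≡ m → All (λ x → ∃ λ (j : Fin n) → x ≡ val j) xs →
             Vec (Fin n) m
fromValues []       refl []              = []
fromValues (x ∷ xs) refl ((j , _) ∷ js) = j ∷ fromValues xs refl js

toValues-fromValues : ∀ {m n} xs (len : length xs ≡ m) (js : All (λ x → ∃ λ (j : Fin n) → x ≡ val j) xs) →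
                      toValues (fromValues xs len js) ≡ xs
toValues-fromValues []       refl []                 = refl
toValues-fromValues (x ∷ xs) refl ((j , refl) ∷ js) = cong (val j ∷_) (toValues-fromValues xs refl js)

words-unique : {A : Set} {xs : List A} → Unique xs → ∀ m → Unique (words xs m)
words-unique xs! zero    = [] ∷ []
words-unique xs! (suc m) =
  concatMap-unique _ xs! (λ _ → Unique.map⁺ Vecₚ.∷-injectiveʳ (words-unique xs! m)) collide
  where
  collide : ∀ {x y z} → _ → _ → z ∈ map (x ∷_) (words _ m) → z ∈ map (y ∷_) (words _ m) → x ≡ y
  collide _ _ z∈ z∈′ with ∈-map⁻ _ z∈ | ∈-map⁻ _ z∈′
  ... | _ , _ , refl | _ , _ , eq = Vecₚ.∷-injectiveˡ eq

∈-words : ∀ {n} m (v : Vec (Fin n) m) → v ∈ words (allFin n) m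
∈-words zero    []      = here refl
∈-words (suc m) (a ∷ v) = ∈-concatMap⁺ _ (Any.map (λ { refl → ∈-map⁺ (a ∷_) (∈-words m v) }) (∈-allFin a))

toValues-Sn↭perms : ∀ n → map toValues (Sn n) ↭ perms n
toValues-Sn↭perms n = unique∧⊆∧⊇⇒↭ Sn-unique (perms-unique n) ⊆perms perms⊆
  where
  Sn-unique : Unique (map toValues (Sn n))
  Sn-unique = Unique.map⁺ toValues-injective (Unique.filter⁺ isPerm? (words-unique (Unique.allFin⁺ n) n))
  ⊆perms : ∀ {τ} → τ ∈ map toValues (Sn n) → τ ∈ perms n
  ⊆perms τ∈ with ∈-map⁻ toValues τ∈
  ... | σ , σ∈ , refl =
    ∈-perms⁺ n (IsPerm⇒toValues↭values σ (proj₂ (∈-filter⁻ isPerm? {xs = words _ n} σ∈)))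
  perms⊆ : ∀ {τ} → τ ∈ perms n → τ ∈ map toValues (Sn n)
  perms⊆ {τ} τ∈ =
    subst (_∈ map toValues (Sn n)) toValues-σ (∈-map⁺ toValues (∈-filter⁺ isPerm? (∈-words n σ) σ-perm))
    where
    τ↭ = ∈-perms⁻ n τ∈
    σ : Vec (Fin n) n
    σ = fromValues τ (trans (↭-length τ↭) (length-applyDownFrom suc n))
                     (All-resp-↭ (↭-sym τ↭) (All.tabulate ∈-values⁻))
    toValues-σ : toValues σ ≡ τ
    toValues-σ = toValues-fromValues τ _ _
    τ-unique : Unique τ
    τ-unique = PermutationSetoid.Unique-resp-↭ (setoid ℕ) (↭⇒↭ₛ (↭-sym τ↭)) (values-unique n)
    σ-perm : IsPerm σ
    σ-perm = toValues-unique⇒lookup-injective σ (subst Unique (sym toValues-σ) τ-unique)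

<⇒<ᵇ≡true : ∀ {m n} → m < n → (m <ᵇ n) ≡ true
<⇒<ᵇ≡true = Equivalence.to T-≡ ∘ <⇒<ᵇ

≥⇒<ᵇ≡false : ∀ {m n} → n ≤ m → (m <ᵇ n) ≡ false
≥⇒<ᵇ≡false {m} {n} n≤m = ¬-not λ m<ᵇn → <⇒≱ (<ᵇ⇒< m n (Equivalence.from T-≡ m<ᵇn)) n≤m

descents : (ℕ → Bool) → List ℕ → ℕ
descents p []          = 0
descents p (a ∷ [])    = 0
descents p (a ∷ b ∷ τ) = (if b <ᵇ a then 𝟙 (p b) else 0) + descents p (b ∷ τ)

desWith-toValues : ∀ p {m n} (v : Vec (Fin n) m) → desWith p v ≡ descents p (toValues v)
desWith-toValues p []          = refl
desWith-toValues p (a ∷ [])    = refl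
desWith-toValues p (a ∷ b ∷ v) = cong (_ +_) (desWith-toValues p (b ∷ v))

startsEven : List ℕ → Bool
startsEven []      = false
startsEven (a ∷ _) = even a

profile : (ℕ → Bool) → List ℕ → Bool × ℕ
profile p τ = startsEven τ , descents p τ

-- Inserting a new maximum x just before b turns the adjacent pair (c , b) into (c , x) (x , b): the
-- number of p-descents rises exactly when b is a p-value that was not already a descent bottom,
-- and it is unchanged when x is appended.
gains : (ℕ → Bool) → ℕ → List ℕ → List Bool
gains p c []      = false ∷ []
gains p c (b ∷ τ) = (not (b <ᵇ c) ∧ p b) ∷ gains p b τ

descents-insertions : ∀ p {x} c τ → c < x → All (_< x) τ →
  map (descents p ∘ (c ∷_)) (insertions x τ) ≡ map (λ g → 𝟙 g + descents p (c ∷ τ)) (gains p c τ)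
descents-insertions p c [] c<x [] rewrite ≥⇒<ᵇ≡false (<⇒≤ c<x) = refl
descents-insertions p {x} c (b ∷ τ) c<x (b<x ∷ τ<x) = cong₂ _∷_ new-head rest
  where
  t = if b <ᵇ c then 𝟙 (p b) else 0
  D = descents p (b ∷ τ)
  new-head : descents p (c ∷ x ∷ b ∷ τ) ≡ 𝟙 (not (b <ᵇ c) ∧ p b) + ((if b <ᵇ c then 𝟙 (p b) else 0) + D)
  new-head rewrite ≥⇒<ᵇ≡false (<⇒≤ c<x) | <⇒<ᵇ≡true b<x with b <ᵇ c
  ... | true  = refl
  ... | false = refl
  rest : map (descents p ∘ (c ∷_)) (map (b ∷_) (insertions x τ)) ≡ map (λ g → 𝟙 g + (t + D)) (gains p b τ)
  rest = begin
    map (descents p ∘ (c ∷_)) (map (b ∷_) (insertions x τ)) ≡⟨ map-∘ (insertions x τ) ⟨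
    map ((t +_) ∘ descents p ∘ (b ∷_)) (insertions x τ)      ≡⟨ map-∘ (insertions x τ) ⟩
    map (t +_) (map (descents p ∘ (b ∷_)) (insertions x τ))
      ≡⟨ cong (map (t +_)) (descents-insertions p b τ b<x τ<x) ⟩
    map (t +_) (map (λ g → 𝟙 g + D) (gains p b τ))          ≡⟨ map-∘ (gains p b τ) ⟨
    map (λ g → t + (𝟙 g + D)) (gains p b τ)
      ≡⟨ map-cong (λ g → x∙yz≈y∙xz t (𝟙 g) D) (gains p b τ) ⟩
    map (λ g → 𝟙 g + (t + D)) (gains p b τ)                  ∎
    where open ≡-Reasoning

tally-gains : ∀ p c τ → tally id (gains p c τ) + descents p (c ∷ τ) ≡ tally p τ
tally-gains p c []      = refl
tally-gains p c (b ∷ τ) with b <ᵇ c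
... | true  = trans (x∙yz≈y∙xz (tally id (gains p b τ)) (𝟙 (p b)) _) (cong (𝟙 (p b) +_) (tally-gains p b τ))
... | false = trans (+-assoc (𝟙 (p b)) (tally id (gains p b τ)) _) (cong (𝟙 (p b) +_) (tally-gains p b τ))

length-gains : ∀ p c τ → length (gains p c τ) ≡ suc (length τ)
length-gains p c []      = refl
length-gains p c (b ∷ τ) = cong suc (length-gains p b τ)

maximum-gains : ∀ p {x} c τ → x ∈ τ → All (_≤ x) (c ∷ τ) → p x ≡ true → 0 < tally id (gains p c τ)
maximum-gains p c (b ∷ τ) (here refl) (c≤b ∷ _) pb rewrite ≥⇒<ᵇ≡false c≤b | pb = s≤s z≤n
maximum-gains p c (b ∷ τ) (there x∈) (_ ∷ b≤x ∷ τ≤x) px =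
  ≤-trans (maximum-gains p b τ x∈ (b≤x ∷ τ≤x) px) (m≤n+m _ _)

spread : Bool × ℕ → ℕ → ℕ → List (Bool × ℕ)
spread (f , d) s z = replicate s (f , suc d) ++ replicate z (f , d)

map-replicate++replicate : {A B : Set} (g : A → B) (s : ℕ) (x : A) (z : ℕ) (y : A) →
  map g (replicate s x ++ replicate z y) ≡ replicate s (g x) ++ replicate z (g y)
map-replicate++replicate g s x z y =
  trans (map-++ g (replicate s x) (replicate z y)) (cong₂ _++_ (map-replicate g s x) (map-replicate g z y))

spread-rotate : ∀ f d s z → (f , d) ∷ spread (f , d) (suc s) z ↭ (f , suc d) ∷ spread (f , d) s (suc z)
spread-rotate f d s z = ↭-trans (swap _ _ ↭-refl) (prep _ (↭-sym (shift _ (replicate s _) _)))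

profiles-insertions : ∀ p {x} a τ → All (_< x) (a ∷ τ) →
  let D = descents p (a ∷ τ); g = gains p a τ in
  map (profile p) (insertions x (a ∷ τ)) ↭
    (even x , 𝟙 (p a) + D) ∷ spread (even a , D) (tally id g) (tally not g)
profiles-insertions p {x} a τ (a<x ∷ τ<x) rewrite <⇒<ᵇ≡true a<x = prep _ (begin
  map (profile p) (map (a ∷_) (insertions x τ))
    ≡⟨ map-∘ (insertions x τ) ⟨
  map ((even a ,_) ∘ descents p ∘ (a ∷_)) (insertions x τ)
    ≡⟨ map-∘ (insertions x τ) ⟩
  map (even a ,_) (map (descents p ∘ (a ∷_)) (insertions x τ))
    ≡⟨ cong (map (even a ,_)) (descents-insertions p a τ a<x τ<x) ⟩
  map (even a ,_) (map (λ g → 𝟙 g + D) g)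
    ≡⟨ map-∘ g ⟨
  map (λ g → even a , 𝟙 g + D) g
    ↭⟨ map⁺ _ (↭-trues++falses g) ⟩
  map (λ g → even a , 𝟙 g + D) (replicate s true ++ replicate z false)
    ≡⟨ map-replicate++replicate _ s true z false ⟩
  spread (even a , D) s z ∎)
  where
  open PermutationReasoning
  D = descents p (a ∷ τ)
  g = gains p a τ
  s = tally id g
  z = tally not g

tally-not-even-values : ∀ n → tally (not ∘ even) (values n) ≡ 𝟙 (not (even n)) + tally even (values n)
tally-not-even-values zero    = refl
tally-not-even-values (suc n) with even n | tally-not-even-values n
... | true  | ih = cong suc ih
... | false | ih = ih

tally-even-values≤ : ∀ n → tally even (values n) ≤ n
tally-even-values≤ n =
  subst (tally even (values n) ≤_) (trans (tally+tally-not even (values n)) (length-applyDownFrom suc n))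
        (m≤m+n _ _)

-- Inserting n + 1 in front adds a descent onto the old first letter; by tally-gains, of the n other
-- slots exactly c ∸ d₀ add one, where c is the number of (q ∘ even)-values among 1..n.
growth : (Bool → Bool) → (n c : ℕ) → Bool × ℕ → List (Bool × ℕ)
growth q n c (f , d) =
  let d₀ = 𝟙 (q f) + d
      s  = c ∸ d₀
  in (even (suc n) , d₀) ∷ spread (f , d) s (n ∸ s)

profiles-insertions-max : ∀ q n {τ} → τ ↭ values (suc n) →
  map (profile (q ∘ even)) (insertions (suc (suc n)) τ) ↭
    growth q (suc n) (tally (q ∘ even) (values (suc n))) (profile (q ∘ even) τ)
profiles-insertions-max q n {[]}    τ↭ = contradiction (↭-length τ↭) λ ()
profiles-insertions-max q n {a ∷ τ} τ↭ =
  ↭-trans (profiles-insertions p a τ (All-resp-↭ (↭-sym τ↭) (All.map s≤s (values-bounded (suc n)))))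
          (↭-reflexive (sym growth≡))
  where
  p = q ∘ even
  D = descents p (a ∷ τ)
  G = tally id (gains p a τ)
  Z = tally not (gains p a τ)
  G≡ : tally p (values (suc n)) ∸ (𝟙 (p a) + D) ≡ G
  G≡ = begin
    tally p (values (suc n)) ∸ (𝟙 (p a) + D) ≡⟨ cong (_∸ (𝟙 (p a) + D)) (tally-↭ p (↭-sym τ↭)) ⟩
    (𝟙 (p a) + tally p τ) ∸ (𝟙 (p a) + D)    ≡⟨ cong (λ t → 𝟙 (p a) + t ∸ (𝟙 (p a) + D)) (tally-gains p a τ) ⟨
    (𝟙 (p a) + (G + D)) ∸ (𝟙 (p a) + D)      ≡⟨ cong (_∸ (𝟙 (p a) + D)) (x∙yz≈y∙xz (𝟙 (p a)) G D) ⟩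
    (G + (𝟙 (p a) + D)) ∸ (𝟙 (p a) + D)      ≡⟨ m+n∸n≡m G (𝟙 (p a) + D) ⟩
    G                                         ∎
    where open ≡-Reasoning
  Z≡ : suc n ∸ G ≡ Z
  Z≡ = begin
    suc n ∸ G                ≡⟨ cong (_∸ G) (trans (↭-length τ↭) (length-applyDownFrom suc (suc n))) ⟨
    length (a ∷ τ) ∸ G       ≡⟨ cong (_∸ G) (length-gains p a τ) ⟨
    length (gains p a τ) ∸ G ≡⟨ cong (_∸ G) (tally+tally-not id (gains p a τ)) ⟨
    (G + Z) ∸ G              ≡⟨ m+n∸m≡n G Z ⟩
    Z                        ∎
    where open ≡-Reasoning
  growth≡ : growth q (suc n) (tally p (values (suc n))) (even a , D) ≡
            (even (suc (suc n)) , 𝟙 (p a) + D) ∷ spread (even a , D) G Z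
  growth≡ rewrite G≡ | Z≡ = refl

-- σ₁ (when even) and the even descent bottoms are distinct even values; an even n is moreover
-- never a descent bottom, and is not σ₁ when σ₁ is odd.
EvenProfileBound : ℕ → ℕ → Bool × ℕ → Set
EvenProfileBound n e (true  , d) = suc d ≤ e
EvenProfileBound n e (false , d) = even n ≡ true → suc d ≤ e

even-profile-bound : ∀ n {τ} → τ ↭ values (suc n) →
  EvenProfileBound (suc n) (tally even (values (suc n))) (profile even τ)
even-profile-bound n {[]} τ↭ = contradiction (↭-length τ↭) λ ()
even-profile-bound n {a ∷ τ} τ↭
  rewrite tally-↭ even (↭-sym τ↭) | sym (tally-gains even a τ) with even a in even-a
... | true  = s≤s (m≤n+m _ _)
... | false = λ even-1+n → +-monoˡ-≤ _ (maximum-gains even a τ (1+n∈τ even-1+n) a∷τ≤1+n even-1+n)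
  where
  a∷τ≤1+n : All (_≤ suc n) (a ∷ τ)
  a∷τ≤1+n = All-resp-↭ (↭-sym τ↭) (values-bounded (suc n))
  1+n∈τ : even (suc n) ≡ true → suc n ∈ τ
  1+n∈τ even-1+n with ∈-resp-↭ (↭-sym τ↭) (here refl)
  ... | here refl = contradiction (trans (sym even-a) even-1+n) λ ()
  ... | there 1+n∈τ = 1+n∈τ

Ξ : Bool × ℕ → Bool × ℕ
Ξ (false , d) = false , d
Ξ (true  , d) = true  , suc d

Ξ-injective : ∀ {y y′} → Ξ y ≡ Ξ y′ → y ≡ y′
Ξ-injective {false , d} {false , d′} eq = eq
Ξ-injective {true  , d} {true  , d′} eq = cong (true ,_) (suc-injective (cong proj₂ eq))
Ξ-injective {false , d} {true  , d′} ()
Ξ-injective {true  , d} {false , d′} ()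

map-Ξ-spread : ∀ y s z → map Ξ (spread y s z) ≡ spread (Ξ y) s z
map-Ξ-spread (false , d) s z = map-replicate++replicate Ξ s _ z _
map-Ξ-spread (true  , d) s z = map-replicate++replicate Ξ s _ z _

m∸n≡1+m∸[1+n] : ∀ {m n} → n < m → m ∸ n ≡ suc (m ∸ suc n)
m∸n≡1+m∸[1+n] = +-∸-assoc 1

spread-shift : ∀ f d {e n} → d < e → e ∸ d ≤ n →
  (f , d) ∷ spread (f , d) (e ∸ d) (n ∸ (e ∸ d)) ↭ (f , suc d) ∷ spread (f , d) (e ∸ suc d) (n ∸ (e ∸ suc d))
spread-shift f d {e} {n} d<e e∸d≤n rewrite m∸n≡1+m∸[1+n] d<e =
  subst (λ z → (f , d) ∷ spread (f , d) (suc t) (n ∸ suc t) ↭ (f , suc d) ∷ spread (f , d) t z)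
        (sym (m∸n≡1+m∸[1+n] e∸d≤n))
        (spread-rotate f d t (n ∸ suc t))
  where t = e ∸ suc d

Ξ-growth : ∀ n e y → e ≤ n → EvenProfileBound n e y →
  map Ξ (growth id n e y) ↭ growth not n (𝟙 (not (even n)) + e) (Ξ y)
Ξ-growth n e (false , d) e≤n bound with even n
... | true  = ↭-trans (prep _ (↭-reflexive (map-Ξ-spread (false , d) (e ∸ d) (n ∸ (e ∸ d)))))
                      (spread-shift false d (bound refl) (≤-trans (m∸n≤m e d) e≤n))
... | false = prep _ (↭-reflexive (map-Ξ-spread (false , d) (e ∸ d) (n ∸ (e ∸ d))))
Ξ-growth n e (true , d) e≤n bound with even n
... | true  = prep _ (↭-reflexive (map-Ξ-spread (true , d) (e ∸ suc d) (n ∸ (e ∸ suc d))))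
... | false = ↭-trans (prep _ (↭-reflexive (map-Ξ-spread (true , d) (e ∸ suc d) (n ∸ (e ∸ suc d)))))
                      (↭-sym (spread-shift true (suc d) (s≤s bound) (≤-trans (m∸n≤m e d) e≤n)))

profiles : (Bool → Bool) → ℕ → List (Bool × ℕ)
profiles q n = map (profile (q ∘ even)) (perms n)

profiles-suc : ∀ q n → profiles q (suc (suc n)) ↭
  concatMap (growth q (suc n) (tally (q ∘ even) (values (suc n)))) (profiles q (suc n))
profiles-suc q n = begin
  map (profile p) (concatMap (insertions (suc (suc n))) (perms (suc n)))
    ≡⟨ map-concatMap (profile p) (insertions (suc (suc n))) (perms (suc n)) ⟩
  concatMap (map (profile p) ∘ insertions (suc (suc n))) (perms (suc n))
    ↭⟨ concatMap-cong-↭ (perms (suc n)) (profiles-insertions-max q n ∘ ∈-perms⁻ (suc n)) ⟩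
  concatMap (growth q (suc n) c ∘ profile p) (perms (suc n))
    ≡⟨ concatMap-map (growth q (suc n) c) (profile p) (perms (suc n)) ⟨
  concatMap (growth q (suc n) c) (profiles q (suc n)) ∎
  where
  open PermutationReasoning
  p = q ∘ even
  c = tally p (values (suc n))

map-Ξ-profiles : ∀ n → map Ξ (profiles id n) ↭ profiles not n
map-Ξ-profiles zero          = ↭-refl
map-Ξ-profiles (suc zero)    = ↭-refl
map-Ξ-profiles (suc (suc n)) = begin
  map Ξ (profiles id (suc N))
    ↭⟨ map⁺ Ξ (profiles-suc id n) ⟩
  map Ξ (concatMap (growth id N e) (profiles id N))
    ≡⟨ map-concatMap Ξ (growth id N e) (profiles id N) ⟩
  concatMap (map Ξ ∘ growth id N e) (profiles id N)
    ≡⟨ concatMap-map _ (profile even) (perms N) ⟩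
  concatMap (map Ξ ∘ growth id N e ∘ profile even) (perms N)
    ↭⟨ concatMap-cong-↭ (perms N) (Ξ-growth N e _ (tally-even-values≤ N) ∘ even-profile-bound n ∘ ∈-perms⁻ N) ⟩
  concatMap (growth not N o ∘ Ξ ∘ profile even) (perms N)
    ≡⟨ concatMap-map _ (Ξ ∘ profile even) (perms N) ⟨
  concatMap (growth not N o) (map (Ξ ∘ profile even) (perms N))
    ≡⟨ cong (concatMap (growth not N o)) (map-∘ (perms N)) ⟩
  concatMap (growth not N o) (map Ξ (profiles id N))
    ↭⟨ concatMap⁺ (growth not N o) (map-Ξ-profiles (suc n)) ⟩
  concatMap (growth not N o) (profiles not N)
    ≡⟨ cong (λ c → concatMap (growth not N c) (profiles not N)) (tally-not-even-values N) ⟨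
  concatMap (growth not N (tally (not ∘ even) (values N))) (profiles not N)
    ↭⟨ profiles-suc not n ⟨
  profiles not (suc N) ∎
  where
  open PermutationReasoning
  N = suc n
  e = tally even (values N)
  o = 𝟙 (not (even N)) + e

multiplicity : Bool × ℕ → List (Bool × ℕ) → ℕ
multiplicity y = length ∘ filter (_≟ᵖ y)
  where _≟ᵖ_ = ≡-dec _≟ᵇ_ _≟_

multiplicity-↭ : ∀ y {xs ys} → xs ↭ ys → multiplicity y xs ≡ multiplicity y ys
multiplicity-↭ y = ↭-length ∘ filter-↭ _

multiplicity-map : (f : Bool × ℕ → Bool × ℕ) → (∀ {y y′} → f y ≡ f y′ → y ≡ y′) →
                   ∀ y xs → multiplicity y xs ≡ multiplicity (f y) (map f xs)
multiplicity-map f f-inj y = length-filter-map _ _ f (λ _ → mk⇔ (cong f) f-inj)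

count≡multiplicity : ∀ q m b k →
  count m b (desWith (q ∘ even)) k ≡ multiplicity (b , k) (profiles q (suc m))
count≡multiplicity q m b k = begin
  count m b (desWith p) k
    ≡⟨ length-filter-map _ _ (profile p ∘ toValues) P⇔Q (Sn n) ⟩
  multiplicity (b , k) (map (profile p ∘ toValues) (Sn n))
    ≡⟨ cong (multiplicity (b , k)) (map-∘ (Sn n)) ⟩
  multiplicity (b , k) (map (profile p) (map toValues (Sn n)))
    ≡⟨ multiplicity-↭ (b , k) (map⁺ (profile p) (toValues-Sn↭perms n)) ⟩
  multiplicity (b , k) (profiles q n) ∎
  where
  open ≡-Reasoning
  n = suc m
  p = q ∘ even
  P⇔Q : (σ : Vec (Fin n) n) → (even (first σ) ≡ b × desWith p σ ≡ k) ⇔ (profile p (toValues σ) ≡ (b , k))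
  P⇔Q σ@(_ ∷ _) rewrite desWith-toValues p σ = ↔⇒⇔ ×-≡,≡↔≡

count-Ξ : ∀ m y → count m (proj₁ y) desE (proj₂ y) ≡ count m (proj₁ (Ξ y)) desO (proj₂ (Ξ y))
count-Ξ m y = begin
  count m (proj₁ y) desE (proj₂ y)           ≡⟨ count≡multiplicity id m _ _ ⟩
  multiplicity y (profiles id n)             ≡⟨ multiplicity-map Ξ Ξ-injective y (profiles id n) ⟩
  multiplicity (Ξ y) (map Ξ (profiles id n)) ≡⟨ multiplicity-↭ (Ξ y) (map-Ξ-profiles n) ⟩
  multiplicity (Ξ y) (profiles not n)        ≡⟨ count≡multiplicity not m _ _ ⟨
  count m (proj₁ (Ξ y)) desO (proj₂ (Ξ y))   ∎
  where
  open ≡-Reasoning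
  n = suc m

theorem5p3 : (m k : ℕ) →
    (count m false desE k ≡ count m false desO k)
      × (count m true desE k ≡ count m true desO (suc k))
theorem5p3 m k = count-Ξ m (false , k) , count-Ξ m (true , k)
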